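{- 1. Let $M\in$ dCBN. If $M^n\to_{\mathtt{dBang}} N$, then there is some $P\in$ dCBN such that $M\to_n^* P$ and $N\to_{\mathtt{dBang}}^* P^n$. 2. Let $M\in$ dCBV. If $M^v\to_{\mathtt{dBang}} N$, then there is some $P\in$ dCBV such that $M\to_v^* P$ and $N\to_{\mathtt{dBang}}^* P^v$.
   Context: $\to_{\mathtt{dBang}}$ is full dBang reduction on $M ::= x \mid \lambda x M \mid MN \mid {!}M \mid \mathrm{der}(M) \mid M[N/x]$, closure under all contexts of $L\langle\lambda xM\rangle P\mapsto L\langle M[P/x]\rangle$, $N[L\langle{!}P\rangle/x]\mapsto L\langle N\{P/x\}\rangle$, $\mathrm{der}(L\langle{!}N\rangle)\mapsto L\langle N\rangle$ with $L::=\square\mid L[N/x]$. dCBN: $L\langle\lambda xM\rangle N\to_n L\langle M[N/x]\rangle$, $M[N/x]\to_n M\{N/x\}$; dCBV: $L\langle\lambda xM\rangle N\to_v L\langle M[N/x]\rangle$, $M[L\langle V\rangle/x]\to_v L\langle M\{V/x\}\rangle$ ($V$ a variable or abstraction). Translations: $x^n=x$, $(\lambda xM)^n=\lambda xM^n$, $(MN)^n=M^n\,{!}N^n$, $(M[N/x])^n=M^n[{!}N^n/x]$; $x^v={!}x$, $(\lambda xM)^v={!}(\lambda xM^v)$, $(MN)^v=L\langle P\rangle N^v$ if $M^v=L\langle{!}P\rangle$ and $\mathrm{der}(M^v)N^v$ otherwise, $(M[N/x])^v=M^v[N^v/x]$. -}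

module Defs where

open import Data.Nat using (ℕ; zero; suc; _+_)
open import Data.List using (List; []; _∷_; length)
open import Data.Product using (_×_; _,_)
open import Data.Maybe using (Maybe; just; nothing)
open import Relation.Binary.Construct.Closure.ReflexiveTransitive using (Star)

-- Variables are de Bruijn indices.  In both calculi, `lam M` and the
-- explicit substitution `es M N` (written M[N/x]) bind index 0 in M.

ext : (ℕ → ℕ) → ℕ → ℕ
ext ρ zero    = zero
ext ρ (suc i) = suc (ρ i)

data Tm : Set where
  var  : ℕ → Tm
  lam  : Tm → Tm
  app  : Tm → Tm → Tm
  bang : Tm → Tm
  der  : Tm → Tm
  es   : Tm → Tm → Tm

renT : (ℕ → ℕ) → Tm → Tm
renT ρ (var i)   = var (ρ i)
renT ρ (lam M)   = lam (renT (ext ρ) M)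
renT ρ (app M N) = app (renT ρ M) (renT ρ N)
renT ρ (bang M)  = bang (renT ρ M)
renT ρ (der M)   = der (renT ρ M)
renT ρ (es M N)  = es (renT (ext ρ) M) (renT ρ N)

extsT : (ℕ → Tm) → ℕ → Tm
extsT σ zero    = var zero
extsT σ (suc i) = renT suc (σ i)

subT : (ℕ → Tm) → Tm → Tm
subT σ (var i)   = σ i
subT σ (lam M)   = lam (subT (extsT σ) M)
subT σ (app M N) = app (subT σ M) (subT σ N)
subT σ (bang M)  = bang (subT σ M)
subT σ (der M)   = der (subT σ M)
subT σ (es M N)  = es (subT (extsT σ) M) (subT σ N)

sing0T : Tm → ℕ → Tm
sing0T P zero    = P
sing0T P (suc i) = var i

_⟦_⟧T : Tm → Tm → Tm
M ⟦ P ⟧T = subT (sing0T P) M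

-- List contexts L ::= □ | L[N/x].  A list [N₁,…,Nₖ] denotes
-- □[Nₖ/xₖ]…[N₁/x₁], i.e. the head is the outermost substitution.
-- The hole lies under  length L  binders.
LT : Set
LT = List Tm

plugT : LT → Tm → Tm
plugT []      M = M
plugT (N ∷ L) M = es (plugT L M) N

wkT : ℕ → Tm → Tm
wkT k = renT (k +_)

infix 4 _↦d_ _⟶d_ _⟶d*_ _↦n_ _↦v_ _⟶n_ _⟶v_ _⟶n*_ _⟶v*_
infixl 30 _⟦_⟧ _⟦_⟧T
infix 40 _ⁿ _ᵛ

data _↦d_ : Tm → Tm → Set where
  dB  : ∀ L M P → app (plugT L (lam M)) P ↦d plugT L (es M (wkT (length L) P))
  s!  : ∀ N L P → es N (plugT L (bang P)) ↦d
                  plugT L ((renT (ext (length L +_)) N) ⟦ P ⟧T)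
  d!  : ∀ L N → der (plugT L (bang N)) ↦d plugT L N

data _⟶d_ : Tm → Tm → Set where
  root  : ∀ {M N} → M ↦d N → M ⟶d N
  lamC  : ∀ {M M'} → M ⟶d M' → lam M ⟶d lam M'
  appL  : ∀ {M M' N} → M ⟶d M' → app M N ⟶d app M' N
  appR  : ∀ {M N N'} → N ⟶d N' → app M N ⟶d app M N'
  bangC : ∀ {M M'} → M ⟶d M' → bang M ⟶d bang M'
  derC  : ∀ {M M'} → M ⟶d M' → der M ⟶d der M'
  esL   : ∀ {M M' N} → M ⟶d M' → es M N ⟶d es M' N
  esR   : ∀ {M N N'} → N ⟶d N' → es M N ⟶d es M N'

_⟶d*_ : Tm → Tm → Set
_⟶d*_ = Star _⟶d_

-- The source calculus (terms of dCBN / dCBV): no ! and no der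

data Λ : Set where
  var : ℕ → Λ
  lam : Λ → Λ
  app : Λ → Λ → Λ
  es  : Λ → Λ → Λ

ren : (ℕ → ℕ) → Λ → Λ
ren ρ (var i)   = var (ρ i)
ren ρ (lam M)   = lam (ren (ext ρ) M)
ren ρ (app M N) = app (ren ρ M) (ren ρ N)
ren ρ (es M N)  = es (ren (ext ρ) M) (ren ρ N)

exts : (ℕ → Λ) → ℕ → Λ
exts σ zero    = var zero
exts σ (suc i) = ren suc (σ i)

sub : (ℕ → Λ) → Λ → Λ
sub σ (var i)   = σ i
sub σ (lam M)   = lam (sub (exts σ) M)
sub σ (app M N) = app (sub σ M) (sub σ N)
sub σ (es M N)  = es (sub (exts σ) M) (sub σ N)

sing0 : Λ → ℕ → Λ
sing0 P zero    = P
sing0 P (suc i) = var i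

_⟦_⟧ : Λ → Λ → Λ
M ⟦ P ⟧ = sub (sing0 P) M

LΛ : Set
LΛ = List Λ

plug : LΛ → Λ → Λ
plug []      M = M
plug (N ∷ L) M = es (plug L M) N

wk : ℕ → Λ → Λ
wk k = ren (k +_)

data Value : Λ → Set where
  vvar : ∀ i → Value (var i)
  vlam : ∀ M → Value (lam M)

data _↦n_ : Λ → Λ → Set where
  dB : ∀ L M N → app (plug L (lam M)) N ↦n plug L (es M (wk (length L) N))
  s  : ∀ M N → es M N ↦n M ⟦ N ⟧

data _↦v_ : Λ → Λ → Set where
  dB : ∀ L M N → app (plug L (lam M)) N ↦v plug L (es M (wk (length L) N))
  sv : ∀ M L V → Value V → es M (plug L V) ↦v plug L ((ren (ext (length L +_)) M) ⟦ V ⟧)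

data Ctx (R : Λ → Λ → Set) : Λ → Λ → Set where
  root : ∀ {M N} → R M N → Ctx R M N
  lamC : ∀ {M M'} → Ctx R M M' → Ctx R (lam M) (lam M')
  appL : ∀ {M M' N} → Ctx R M M' → Ctx R (app M N) (app M' N)
  appR : ∀ {M N N'} → Ctx R N N' → Ctx R (app M N) (app M N')
  esL  : ∀ {M M' N} → Ctx R M M' → Ctx R (es M N) (es M' N)
  esR  : ∀ {M N N'} → Ctx R N N' → Ctx R (es M N) (es M N')

_⟶n_ : Λ → Λ → Set
_⟶n_ = Ctx _↦n_

_⟶v_ : Λ → Λ → Set
_⟶v_ = Ctx _↦v_

_⟶n*_ : Λ → Λ → Set
_⟶n*_ = Star _⟶n_

_⟶v*_ : Λ → Λ → Set
_⟶v*_ = Star _⟶v_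

_ⁿ : Λ → Tm
(var i) ⁿ   = var i
(lam M) ⁿ   = lam (M ⁿ)
(app M N) ⁿ = app (M ⁿ) (bang (N ⁿ))
(es M N) ⁿ  = es (M ⁿ) (bang (N ⁿ))

decompBang : Tm → Maybe (LT × Tm)
decompBang (bang P) = just ([] , P)
decompBang (es M N) with decompBang M
... | just (L , P) = just (N ∷ L , P)
... | nothing      = nothing
decompBang _ = nothing

appᵛ : Tm → Tm → Tm
appᵛ Mv Nv with decompBang Mv
... | just (L , P) = app (plugT L P) Nv
... | nothing      = app (der Mv) Nv

_ᵛ : Λ → Tm
(var i) ᵛ   = bang (var i)
(lam M) ᵛ   = bang (lam (M ᵛ))
(app M N) ᵛ = appᵛ (M ᵛ) (N ᵛ)
(es M N) ᵛ  = es (M ᵛ) (N ᵛ)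

module Submission where

-- A dBang step from
-- Mⁿ or Mᵛ either happens inside the image of an immediate subterm, where the
-- induction hypothesis applies and is carried through the surrounding
-- constructor, or it is a root redex.  Root redexes of images are images of
-- source redexes: in a dB redex L⟨λB⟩P the context L comes from the source,
-- and the argument L⟨!P⟩ of an s! redex is the image of an argument (CBN) or
-- of a value in a list context (CBV).  Since both translations commute with
-- renaming and substitution, the two reducts coincide up to translation.
-- The one mismatch is CBV application, whose image depends on whether Mᵛ has
-- the form L⟨!P⟩: after a step in M at most one d! step restores it.

open import Defs
open import Data.Product using (_×_; ∃; ∃₂; Σ; _,_)
open import Data.Nat using (ℕ; zero; suc; _+_)
open import Data.List using ([]; _∷_; length; map; _++_)
open import Data.List.Properties using (length-map)
open import Data.Maybe using (just; nothing)
open import Data.Sum using (_⊎_; inj₁; inj₂)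
open import Data.Empty using (⊥; ⊥-elim)
open import Data.Unit using (⊤; tt)
open import Function using (id; _∘_)
open import Relation.Binary.PropositionalEquality
open import Relation.Binary.Construct.Closure.ReflexiveTransitive using (ε; _◅_; _◅◅_; gmap)
open ≡-Reasoning

≡⇒⟶d* : ∀ {A B} → A ≡ B → A ⟶d* B
≡⇒⟶d* refl = ε

es-injective : ∀ {A B C D : Tm} → es A B ≡ es C D → A ≡ C × B ≡ D
es-injective refl = refl , refl

renLT : (ℕ → ℕ) → LT → LT
renLT ρ []      = []
renLT ρ (N ∷ L) = renT ρ N ∷ renLT (ext ρ) L

extUnder : LT → (ℕ → ℕ) → ℕ → ℕ
extUnder []      ρ = ρ
extUnder (_ ∷ L) ρ = extUnder L (ext ρ)

renT-plugT : ∀ ρ L X → renT ρ (plugT L X) ≡ plugT (renLT ρ L) (renT (extUnder L ρ) X)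
renT-plugT ρ []      X = refl
renT-plugT ρ (N ∷ L) X = cong (λ Z → es Z (renT ρ N)) (renT-plugT (ext ρ) L X)

subLT : (ℕ → Tm) → LT → LT
subLT σ []      = []
subLT σ (N ∷ L) = subT σ N ∷ subLT (extsT σ) L

extsUnder : LT → (ℕ → Tm) → ℕ → Tm
extsUnder []      σ = σ
extsUnder (_ ∷ L) σ = extsUnder L (extsT σ)

subT-plugT : ∀ σ L X → subT σ (plugT L X) ≡ plugT (subLT σ L) (subT (extsUnder L σ) X)
subT-plugT σ []      X = refl
subT-plugT σ (N ∷ L) X = cong (λ Z → es Z (subT σ N)) (subT-plugT (extsT σ) L X)

plugT-++ : ∀ K L X → plugT K (plugT L X) ≡ plugT (K ++ L) X
plugT-++ []      L X = refl
plugT-++ (N ∷ K) L X = cong (λ Z → es Z N) (plugT-++ K L X)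

plugT-cong : ∀ L {X X'} → X ⟶d X' → plugT L X ⟶d plugT L X'
plugT-cong []      st = st
plugT-cong (_ ∷ L) st = esL (plugT-cong L st)

NotEs : Tm → Set
NotEs (es _ _) = ⊥
NotEs _        = ⊤

plugT-injective : ∀ L L' {X Y} → NotEs X → NotEs Y →
  plugT L X ≡ plugT L' Y → L ≡ L' × X ≡ Y
plugT-injective []      []       _  _  e    = refl , e
plugT-injective []      (_ ∷ _)  nx _  refl = ⊥-elim nx
plugT-injective (_ ∷ _) []       _  ny refl = ⊥-elim ny
plugT-injective (_ ∷ L) (_ ∷ L') nx ny e with es-injective e
... | e₁ , refl with plugT-injective L L' nx ny e₁
...   | refl , e₂ = refl , e₂

↦d-app-inv : ∀ {A B T} → app A B ↦d T →
  ∃₂ λ L M → A ≡ plugT L (lam M) × T ≡ plugT L (es M (wkT (length L) B))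
↦d-app-inv (dB L M _) = L , M , refl , refl

↦d-es-inv : ∀ {N A T} → es N A ↦d T →
  ∃₂ λ L P → A ≡ plugT L (bang P) × T ≡ plugT L ((renT (ext (length L +_)) N) ⟦ P ⟧T)
↦d-es-inv (s! _ L P) = L , P , refl , refl

↦d-der-inv : ∀ {A T} → der A ↦d T → ∃₂ λ L P → A ≡ plugT L (bang P)
↦d-der-inv (d! L P) = L , P , refl

s!-ctx : LT → Tm → LT → LT
s!-ctx K Q L = K ++ subLT (sing0T Q) (renLT (ext (length K +_)) L)

s!-hole : LT → Tm → LT → Tm → Tm
s!-hole K Q L Y =
  subT (extsUnder (renLT (ext (length K +_)) L) (sing0T Q)) (renT (extUnder L (ext (length K +_))) Y)

s!-reduct-plugT : ∀ K Q L Y →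
  plugT K ((renT (ext (length K +_)) (plugT L Y)) ⟦ Q ⟧T) ≡ plugT (s!-ctx K Q L) (s!-hole K Q L Y)
s!-reduct-plugT K Q L Y = begin
  plugT K (subT (sing0T Q) (renT ρ (plugT L Y)))
    ≡⟨ cong (plugT K ∘ subT (sing0T Q)) (renT-plugT ρ L Y) ⟩
  plugT K (subT (sing0T Q) (plugT (renLT ρ L) (renT (extUnder L ρ) Y)))
    ≡⟨ cong (plugT K) (subT-plugT (sing0T Q) (renLT ρ L) _) ⟩
  plugT K (plugT (subLT (sing0T Q) (renLT ρ L)) (s!-hole K Q L Y))
    ≡⟨ plugT-++ K _ _ ⟩
  plugT (s!-ctx K Q L) (s!-hole K Q L Y) ∎
  where ρ = ext (length K +_)

-- A step of L⟨X⟩ reduces X or L; in the latter case an s! redex of L may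
-- rename and substitute into the hole, but uniformly in its content.
data PlugStep (L : LT) (X A : Tm) : Set where
  inHole    : ∀ {X'} → X ⟶d X' → A ≡ plugT L X' → PlugStep L X A
  inContext : ∀ L' (θ : Tm → Tm) → (∀ Y → θ (bang Y) ≡ bang (θ Y)) →
              A ≡ plugT L' (θ X) → (∀ Y → plugT L Y ⟶d plugT L' (θ Y)) → PlugStep L X A

plugStep : ∀ L X {A} → plugT L X ⟶d A → PlugStep L X A
plugStep []      X st = inHole st refl
plugStep (N ∷ L) X (esL st) with plugStep L X st
... | inHole st' refl = inHole st' refl
... | inContext L' θ θ-bang refl step = inContext (N ∷ L') θ θ-bang refl (esL ∘ step)
plugStep (N ∷ L) X (esR {N' = N'} st) = inContext (N' ∷ L) id (λ _ → refl) refl (λ _ → esR st)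
plugStep (_ ∷ L) X (root r) with ↦d-es-inv r
... | K , Q , refl , refl =
  inContext (s!-ctx K Q L) (s!-hole K Q L) (λ _ → refl) (s!-reduct-plugT K Q L X)
    (λ Y → subst (es (plugT L Y) (plugT K (bang Q)) ⟶d_) (s!-reduct-plugT K Q L Y)
                 (root (s! (plugT L Y) K Q)))

bang-step : ∀ L P {A} → plugT L (bang P) ⟶d A →
  ∃₂ λ L' P' → A ≡ plugT L' (bang P') × plugT L P ⟶d plugT L' P'
bang-step L P st with plugStep L (bang P) st
... | inHole (bangC st') refl = L , _ , refl , plugT-cong L st'
... | inHole (root ()) _
... | inContext L' θ θ-bang refl step = L' , θ P , cong (plugT L') (θ-bang P) , step P

unbang-step : ∀ L Q {A} → plugT L Q ⟶d A →
  ∃₂ λ L' Q' → A ≡ plugT L' Q' × plugT L (bang Q) ⟶d plugT L' (bang Q')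
unbang-step L Q st with plugStep L Q st
... | inHole st' refl = L , _ , refl , plugT-cong L (bangC st')
... | inContext L' θ θ-bang refl step =
  L' , θ Q , refl , subst (plugT L (bang Q) ⟶d_) (cong (plugT L') (θ-bang Q)) (step (bang Q))

decompBang-plugT-bang : ∀ L P → decompBang (plugT L (bang P)) ≡ just (L , P)
decompBang-plugT-bang []      P = refl
decompBang-plugT-bang (_ ∷ L) P rewrite decompBang-plugT-bang L P = refl

decompBang-plugT-app : ∀ L X Y → decompBang (plugT L (app X Y)) ≡ nothing
decompBang-plugT-app []      X Y = refl
decompBang-plugT-app (_ ∷ L) X Y rewrite decompBang-plugT-app L X Y = refl

decompBang-view : ∀ X → (∃₂ λ L P → X ≡ plugT L (bang P)) ⊎ decompBang X ≡ nothing
decompBang-view (var _)   = inj₂ refl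
decompBang-view (lam _)   = inj₂ refl
decompBang-view (app _ _) = inj₂ refl
decompBang-view (bang P)  = inj₁ ([] , P , refl)
decompBang-view (der _)   = inj₂ refl
decompBang-view (es M N) with decompBang-view M
... | inj₁ (L , P , refl) = inj₁ (N ∷ L , P , refl)
... | inj₂ nd             = inj₂ (decompBang-es nd)
  where
  decompBang-es : decompBang M ≡ nothing → decompBang (es M N) ≡ nothing
  decompBang-es nd rewrite nd = refl

appᵛ-plugT-bang : ∀ L P B → appᵛ (plugT L (bang P)) B ≡ app (plugT L P) B
appᵛ-plugT-bang L P B rewrite decompBang-plugT-bang L P = refl

appᵛ-der : ∀ X B → decompBang X ≡ nothing → appᵛ X B ≡ app (der X) B
appᵛ-der X B nd rewrite nd = refl

appᵛ-is-app : ∀ A B → ∃₂ λ X Y → appᵛ A B ≡ app X Y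
appᵛ-is-app A B with decompBang A
... | just _  = _ , _ , refl
... | nothing = _ , _ , refl

app-der⟶d*appᵛ : ∀ X B → app (der X) B ⟶d* appᵛ X B
app-der⟶d*appᵛ X B with decompBang-view X
... | inj₁ (L , P , refl) =
  subst (app (der X) B ⟶d*_) (sym (appᵛ-plugT-bang L P B)) (appL (root (d! L P)) ◅ ε)
... | inj₂ nd = subst (app (der X) B ⟶d*_) (sym (appᵛ-der X B nd)) ε

appᵛ-⟶dˡ : ∀ {X X'} B → X ⟶d X' → appᵛ X B ⟶d* appᵛ X' B
appᵛ-⟶dˡ {X} {X'} B st with decompBang-view X
... | inj₂ nd = subst (_⟶d* appᵛ X' B) (sym (appᵛ-der X B nd)) (appL (derC st) ◅ app-der⟶d*appᵛ X' B)
... | inj₁ (L , P , refl) with bang-step L P st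
...   | L' , P' , refl , st' =
  subst₂ _⟶d*_ (sym (appᵛ-plugT-bang L P B)) (sym (appᵛ-plugT-bang L' P' B)) (appL st' ◅ ε)

appᵛ-⟶d*ˡ : ∀ {X X'} B → X ⟶d* X' → appᵛ X B ⟶d* appᵛ X' B
appᵛ-⟶d*ˡ B ε          = ε
appᵛ-⟶d*ˡ B (st ◅ sts) = appᵛ-⟶dˡ B st ◅◅ appᵛ-⟶d*ˡ B sts

-- Images of CBV terms are L⟨!Q⟩ or L⟨X Y⟩, the shapes on which appᵛ is stable
-- under renaming and substitution.
data Headed : Tm → Set where
  bangHead : ∀ L Q → Headed (plugT L (bang Q))
  appHead  : ∀ L X Y → Headed (plugT L (app X Y))

renT-appᵛ : ∀ ρ {X} B → Headed X → renT ρ (appᵛ X B) ≡ appᵛ (renT ρ X) (renT ρ B)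
renT-appᵛ ρ B (bangHead L Q) = begin
  renT ρ (appᵛ (plugT L (bang Q)) B)
    ≡⟨ cong (renT ρ) (appᵛ-plugT-bang L Q B) ⟩
  app (renT ρ (plugT L Q)) (renT ρ B)
    ≡⟨ cong (λ Z → app Z (renT ρ B)) (renT-plugT ρ L Q) ⟩
  app (plugT (renLT ρ L) (renT (extUnder L ρ) Q)) (renT ρ B)
    ≡⟨ sym (appᵛ-plugT-bang (renLT ρ L) _ (renT ρ B)) ⟩
  appᵛ (plugT (renLT ρ L) (bang (renT (extUnder L ρ) Q))) (renT ρ B)
    ≡⟨ cong (λ Z → appᵛ Z (renT ρ B)) (sym (renT-plugT ρ L (bang Q))) ⟩
  appᵛ (renT ρ (plugT L (bang Q))) (renT ρ B) ∎
renT-appᵛ ρ B (appHead L X Y) = begin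
  renT ρ (appᵛ (plugT L (app X Y)) B)
    ≡⟨ cong (renT ρ) (appᵛ-der (plugT L (app X Y)) B (decompBang-plugT-app L X Y)) ⟩
  app (der (renT ρ (plugT L (app X Y)))) (renT ρ B)
    ≡⟨ sym (appᵛ-der (renT ρ (plugT L (app X Y))) (renT ρ B) nd) ⟩
  appᵛ (renT ρ (plugT L (app X Y))) (renT ρ B) ∎
  where
  nd : decompBang (renT ρ (plugT L (app X Y))) ≡ nothing
  nd = trans (cong decompBang (renT-plugT ρ L (app X Y))) (decompBang-plugT-app (renLT ρ L) _ _)

subT-appᵛ : ∀ σ {X} B → Headed X → subT σ (appᵛ X B) ≡ appᵛ (subT σ X) (subT σ B)
subT-appᵛ σ B (bangHead L Q) = begin
  subT σ (appᵛ (plugT L (bang Q)) B)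
    ≡⟨ cong (subT σ) (appᵛ-plugT-bang L Q B) ⟩
  app (subT σ (plugT L Q)) (subT σ B)
    ≡⟨ cong (λ Z → app Z (subT σ B)) (subT-plugT σ L Q) ⟩
  app (plugT (subLT σ L) (subT (extsUnder L σ) Q)) (subT σ B)
    ≡⟨ sym (appᵛ-plugT-bang (subLT σ L) _ (subT σ B)) ⟩
  appᵛ (plugT (subLT σ L) (bang (subT (extsUnder L σ) Q))) (subT σ B)
    ≡⟨ cong (λ Z → appᵛ Z (subT σ B)) (sym (subT-plugT σ L (bang Q))) ⟩
  appᵛ (subT σ (plugT L (bang Q))) (subT σ B) ∎
subT-appᵛ σ B (appHead L X Y) = begin
  subT σ (appᵛ (plugT L (app X Y)) B)
    ≡⟨ cong (subT σ) (appᵛ-der (plugT L (app X Y)) B (decompBang-plugT-app L X Y)) ⟩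
  app (der (subT σ (plugT L (app X Y)))) (subT σ B)
    ≡⟨ sym (appᵛ-der (subT σ (plugT L (app X Y))) (subT σ B) nd) ⟩
  appᵛ (subT σ (plugT L (app X Y))) (subT σ B) ∎
  where
  nd : decompBang (subT σ (plugT L (app X Y))) ≡ nothing
  nd = trans (cong decompBang (subT-plugT σ L (app X Y))) (decompBang-plugT-app (subLT σ L) _ _)

ⁿ-ren : ∀ ρ M → (ren ρ M) ⁿ ≡ renT ρ (M ⁿ)
ⁿ-ren ρ (var i)   = refl
ⁿ-ren ρ (lam M)   = cong lam (ⁿ-ren (ext ρ) M)
ⁿ-ren ρ (app M N) = cong₂ (λ A B → app A (bang B)) (ⁿ-ren ρ M) (ⁿ-ren ρ N)
ⁿ-ren ρ (es M N)  = cong₂ (λ A B → es A (bang B)) (ⁿ-ren (ext ρ) M) (ⁿ-ren ρ N)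

extsⁿ : ∀ {σ σ'} → (∀ i → (σ i) ⁿ ≡ σ' i) → ∀ i → (exts σ i) ⁿ ≡ extsT σ' i
extsⁿ h zero          = refl
extsⁿ {σ} h (suc i) = trans (ⁿ-ren suc (σ i)) (cong (renT suc) (h i))

ⁿ-sub : ∀ {σ σ'} → (∀ i → (σ i) ⁿ ≡ σ' i) → ∀ M → (sub σ M) ⁿ ≡ subT σ' (M ⁿ)
ⁿ-sub h (var i)   = h i
ⁿ-sub h (lam M)   = cong lam (ⁿ-sub (extsⁿ h) M)
ⁿ-sub h (app M N) = cong₂ (λ A B → app A (bang B)) (ⁿ-sub h M) (ⁿ-sub h N)
ⁿ-sub h (es M N)  = cong₂ (λ A B → es A (bang B)) (ⁿ-sub (extsⁿ h) M) (ⁿ-sub h N)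

mapⁿ : LΛ → LT
mapⁿ = map (λ N → bang (N ⁿ))

ⁿ-plug : ∀ L M → (plug L M) ⁿ ≡ plugT (mapⁿ L) (M ⁿ)
ⁿ-plug []      M = refl
ⁿ-plug (N ∷ L) M = cong (λ Z → es Z (bang (N ⁿ))) (ⁿ-plug L M)

ext-id : ∀ {ρ} → (∀ i → ρ i ≡ i) → ∀ i → ext ρ i ≡ i
ext-id h zero    = refl
ext-id h (suc i) = cong suc (h i)

renT-id : ∀ {ρ} → (∀ i → ρ i ≡ i) → ∀ X → renT ρ X ≡ X
renT-id h (var i)   = cong var (h i)
renT-id h (lam X)   = cong lam (renT-id (ext-id h) X)
renT-id h (app X Y) = cong₂ app (renT-id h X) (renT-id h Y)
renT-id h (bang X)  = cong bang (renT-id h X)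
renT-id h (der X)   = cong der (renT-id h X)
renT-id h (es X Y)  = cong₂ es (renT-id (ext-id h) X) (renT-id h Y)

ⁿ-plugT-lam-inv : ∀ M L B → M ⁿ ≡ plugT L (lam B) →
  ∃₂ λ L₀ B₀ → M ≡ plug L₀ (lam B₀) × L ≡ mapⁿ L₀ × B ≡ B₀ ⁿ
ⁿ-plugT-lam-inv (lam B₀) [] _ refl = [] , B₀ , refl , refl , refl
ⁿ-plugT-lam-inv (es M N) (_ ∷ L) B e with es-injective e
... | e₁ , refl with ⁿ-plugT-lam-inv M L B e₁
...   | L₀ , B₀ , refl , refl , refl = N ∷ L₀ , B₀ , refl , refl , refl
ⁿ-plugT-lam-inv (var _)   []      _ ()
ⁿ-plugT-lam-inv (app _ _) []      _ ()
ⁿ-plugT-lam-inv (es _ _)  []      _ ()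
ⁿ-plugT-lam-inv (var _)   (_ ∷ _) _ ()
ⁿ-plugT-lam-inv (lam _)   (_ ∷ _) _ ()
ⁿ-plugT-lam-inv (app _ _) (_ ∷ _) _ ()

ⁿ-dB-reduct : ∀ L B N →
  (plug L (es B (wk (length L) N))) ⁿ ≡ plugT (mapⁿ L) (es (B ⁿ) (wkT (length (mapⁿ L)) (bang (N ⁿ))))
ⁿ-dB-reduct L B N = begin
  (plug L (es B (wk (length L) N))) ⁿ
    ≡⟨ ⁿ-plug L _ ⟩
  plugT (mapⁿ L) (es (B ⁿ) (bang ((wk (length L) N) ⁿ)))
    ≡⟨ cong (λ Z → plugT (mapⁿ L) (es (B ⁿ) (bang Z))) (ⁿ-ren (length L +_) N) ⟩
  plugT (mapⁿ L) (es (B ⁿ) (bang (wkT (length L) (N ⁿ))))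
    ≡⟨ cong (λ k → plugT (mapⁿ L) (es (B ⁿ) (bang (wkT k (N ⁿ))))) (sym (length-map _ L)) ⟩
  plugT (mapⁿ L) (es (B ⁿ) (bang (wkT (length (mapⁿ L)) (N ⁿ)))) ∎

ⁿ-s-reduct : ∀ M N → (M ⟦ N ⟧) ⁿ ≡ (renT (ext id) (M ⁿ)) ⟦ N ⁿ ⟧T
ⁿ-s-reduct M N = begin
  (M ⟦ N ⟧) ⁿ                         ≡⟨ ⁿ-sub single M ⟩
  (M ⁿ) ⟦ N ⁿ ⟧T                      ≡⟨ cong (_⟦ N ⁿ ⟧T) (sym (renT-id (ext-id (λ _ → refl)) (M ⁿ))) ⟩
  (renT (ext id) (M ⁿ)) ⟦ N ⁿ ⟧T ∎
  where
  single : ∀ i → (sing0 N i) ⁿ ≡ sing0T (N ⁿ) i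
  single zero    = refl
  single (suc i) = refl

simulationⁿ : ∀ M {X} → M ⁿ ⟶d X → ∃ λ P → M ⟶n* P × X ⟶d* P ⁿ
simulationⁿ (var _) (root ())
simulationⁿ (lam _) (root ())
simulationⁿ (lam M) (lamC st) with simulationⁿ M st
... | P , M↠P , X↠Pⁿ = lam P , gmap lam lamC M↠P , gmap lam lamC X↠Pⁿ
simulationⁿ (app M N) (root r) with ↦d-app-inv r
... | L , B , e , refl with ⁿ-plugT-lam-inv M L B e
...   | L₀ , B₀ , refl , refl , refl =
  _ , root (dB L₀ B₀ N) ◅ ε , ≡⇒⟶d* (sym (ⁿ-dB-reduct L₀ B₀ N))
simulationⁿ (app M N) (appL st) with simulationⁿ M st
... | P , M↠P , X↠Pⁿ = app P N , gmap (λ Z → app Z N) appL M↠P , gmap (λ Z → app Z (bang (N ⁿ))) appL X↠Pⁿ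
simulationⁿ (app M N) (appR (bangC st)) with simulationⁿ N st
... | P , N↠P , X↠Pⁿ = app M P , gmap (app M) appR N↠P , gmap (λ Z → app (M ⁿ) (bang Z)) (λ st' → appR (bangC st')) X↠Pⁿ
simulationⁿ (app M N) (appR (root ()))
simulationⁿ (es M N) (root r) with ↦d-es-inv r
... | [] , _ , refl , refl = M ⟦ N ⟧ , root (s M N) ◅ ε , ≡⇒⟶d* (sym (ⁿ-s-reduct M N))
... | _ ∷ _ , _ , () , _
simulationⁿ (es M N) (esL st) with simulationⁿ M st
... | P , M↠P , X↠Pⁿ = es P N , gmap (λ Z → es Z N) esL M↠P , gmap (λ Z → es Z (bang (N ⁿ))) esL X↠Pⁿ
simulationⁿ (es M N) (esR (bangC st)) with simulationⁿ N st
... | P , N↠P , X↠Pⁿ = es M P , gmap (es M) esR N↠P , gmap (λ Z → es (M ⁿ) (bang Z)) (λ st' → esR (bangC st')) X↠Pⁿ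
simulationⁿ (es M N) (esR (root ()))

unbangᵛ : ∀ {V} → Value V → Tm
unbangᵛ (vvar i) = var i
unbangᵛ (vlam M) = lam (M ᵛ)

ᵛ-value : ∀ {V} (v : Value V) → V ᵛ ≡ bang (unbangᵛ v)
ᵛ-value (vvar _) = refl
ᵛ-value (vlam _) = refl

mapᵛ : LΛ → LT
mapᵛ = map _ᵛ

ᵛ-plug : ∀ L M → (plug L M) ᵛ ≡ plugT (mapᵛ L) (M ᵛ)
ᵛ-plug []      M = refl
ᵛ-plug (N ∷ L) M = cong (λ Z → es Z (N ᵛ)) (ᵛ-plug L M)

ᵛ-plug-value : ∀ L {V} (v : Value V) → (plug L V) ᵛ ≡ plugT (mapᵛ L) (bang (unbangᵛ v))
ᵛ-plug-value L {V} v = trans (ᵛ-plug L V) (cong (plugT (mapᵛ L)) (ᵛ-value v))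

data HeadView (M : Λ) : Set where
  valueIn : ∀ L {V} (v : Value V) → M ≡ plug L V → HeadView M
  appIn   : ∀ L X Y → M ᵛ ≡ plugT L (app X Y) → HeadView M

headView : ∀ M → HeadView M
headView (var i)   = valueIn [] (vvar i) refl
headView (lam M)   = valueIn [] (vlam M) refl
headView (app M N) with appᵛ-is-app (M ᵛ) (N ᵛ)
... | X , Y , e = appIn [] X Y e
headView (es M N) with headView M
... | valueIn L v refl = valueIn (N ∷ L) v refl
... | appIn L X Y e    = appIn (N ᵛ ∷ L) X Y (cong (λ Z → es Z (N ᵛ)) e)

headed : ∀ M → Headed (M ᵛ)
headed M with headView M
... | valueIn L v refl = subst Headed (sym (ᵛ-plug-value L v)) (bangHead _ _)
... | appIn L X Y e    = subst Headed (sym e) (appHead L X Y)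

ᵛ-ren : ∀ ρ M → (ren ρ M) ᵛ ≡ renT ρ (M ᵛ)
ᵛ-ren ρ (var i)   = refl
ᵛ-ren ρ (lam M)   = cong (bang ∘ lam) (ᵛ-ren (ext ρ) M)
ᵛ-ren ρ (app M N) = trans (cong₂ appᵛ (ᵛ-ren ρ M) (ᵛ-ren ρ N)) (sym (renT-appᵛ ρ (N ᵛ) (headed M)))
ᵛ-ren ρ (es M N)  = cong₂ es (ᵛ-ren (ext ρ) M) (ᵛ-ren ρ N)

-- Only values are substituted in CBV, and their images are !-terms.
extsᵛ : ∀ {σ σ'} → (∀ i → (σ i) ᵛ ≡ bang (σ' i)) → ∀ i → (exts σ i) ᵛ ≡ bang (extsT σ' i)
extsᵛ h zero        = refl
extsᵛ {σ} h (suc i) = trans (ᵛ-ren suc (σ i)) (cong (renT suc) (h i))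

ᵛ-sub : ∀ {σ σ'} → (∀ i → (σ i) ᵛ ≡ bang (σ' i)) → ∀ M → (sub σ M) ᵛ ≡ subT σ' (M ᵛ)
ᵛ-sub h (var i)   = h i
ᵛ-sub h (lam M)   = cong (bang ∘ lam) (ᵛ-sub (extsᵛ h) M)
ᵛ-sub {σ' = σ'} h (app M N) =
  trans (cong₂ appᵛ (ᵛ-sub h M) (ᵛ-sub h N)) (sym (subT-appᵛ σ' (N ᵛ) (headed M)))
ᵛ-sub h (es M N)  = cong₂ es (ᵛ-sub (extsᵛ h) M) (ᵛ-sub h N)

ᵛ-plugT-bang-inv : ∀ M L Q → M ᵛ ≡ plugT L (bang Q) →
  ∃₂ λ L₀ V → Σ (Value V) λ v → M ≡ plug L₀ V × L ≡ mapᵛ L₀ × Q ≡ unbangᵛ v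
ᵛ-plugT-bang-inv M L Q e with headView M
... | valueIn L₀ v refl with plugT-injective (mapᵛ L₀) L tt tt (trans (sym (ᵛ-plug-value L₀ v)) e)
...   | refl , refl = L₀ , _ , v , refl , refl , refl
ᵛ-plugT-bang-inv M L Q e | appIn L' X Y e' with plugT-injective L' L tt tt (trans (sym e') e)
...   | refl , ()

ᵛ-app-value : ∀ L {V} (v : Value V) N → (app (plug L V) N) ᵛ ≡ app (plugT (mapᵛ L) (unbangᵛ v)) (N ᵛ)
ᵛ-app-value L v N = trans (cong (λ Z → appᵛ Z (N ᵛ)) (ᵛ-plug-value L v)) (appᵛ-plugT-bang _ _ _)

ᵛ-dB-reduct : ∀ L B N →
  (plug L (es B (wk (length L) N))) ᵛ ≡ plugT (mapᵛ L) (es (B ᵛ) (wkT (length (mapᵛ L)) (N ᵛ)))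
ᵛ-dB-reduct L B N = begin
  (plug L (es B (wk (length L) N))) ᵛ
    ≡⟨ ᵛ-plug L _ ⟩
  plugT (mapᵛ L) (es (B ᵛ) ((wk (length L) N) ᵛ))
    ≡⟨ cong (λ Z → plugT (mapᵛ L) (es (B ᵛ) Z)) (ᵛ-ren (length L +_) N) ⟩
  plugT (mapᵛ L) (es (B ᵛ) (wkT (length L) (N ᵛ)))
    ≡⟨ cong (λ k → plugT (mapᵛ L) (es (B ᵛ) (wkT k (N ᵛ)))) (sym (length-map _ᵛ L)) ⟩
  plugT (mapᵛ L) (es (B ᵛ) (wkT (length (mapᵛ L)) (N ᵛ))) ∎

ᵛ-sv-reduct : ∀ M L {V} (v : Value V) →
  (plug L ((ren (ext (length L +_)) M) ⟦ V ⟧)) ᵛ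
    ≡ plugT (mapᵛ L) ((renT (ext (length (mapᵛ L) +_)) (M ᵛ)) ⟦ unbangᵛ v ⟧T)
ᵛ-sv-reduct M L {V} v = begin
  (plug L ((ren ρ M) ⟦ V ⟧)) ᵛ
    ≡⟨ ᵛ-plug L _ ⟩
  plugT (mapᵛ L) (((ren ρ M) ⟦ V ⟧) ᵛ)
    ≡⟨ cong (plugT (mapᵛ L)) (ᵛ-sub single (ren ρ M)) ⟩
  plugT (mapᵛ L) (((ren ρ M) ᵛ) ⟦ unbangᵛ v ⟧T)
    ≡⟨ cong (λ Z → plugT (mapᵛ L) (Z ⟦ unbangᵛ v ⟧T)) (ᵛ-ren ρ M) ⟩
  plugT (mapᵛ L) ((renT ρ (M ᵛ)) ⟦ unbangᵛ v ⟧T)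
    ≡⟨ cong (λ k → plugT (mapᵛ L) ((renT (ext (k +_)) (M ᵛ)) ⟦ unbangᵛ v ⟧T)) (sym (length-map _ᵛ L)) ⟩
  plugT (mapᵛ L) ((renT (ext (length (mapᵛ L) +_)) (M ᵛ)) ⟦ unbangᵛ v ⟧T) ∎
  where
  ρ = ext (length L +_)
  single : ∀ i → (sing0 V i) ᵛ ≡ bang (sing0T (unbangᵛ v) i)
  single zero    = ᵛ-value v
  single (suc i) = refl

Simulationᵛ : Λ → Set
Simulationᵛ M = ∀ {X} → M ᵛ ⟶d X → ∃ λ P → M ⟶v* P × X ⟶d* P ᵛ

simulationᵛ-app-value : ∀ L {V} (v : Value V) N → Simulationᵛ (plug L V) → Simulationᵛ N →
  ∀ {X} → app (plugT (mapᵛ L) (unbangᵛ v)) (N ᵛ) ⟶d X → ∃ λ P → app (plug L V) N ⟶v* P × X ⟶d* P ᵛ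
simulationᵛ-app-value L (vvar i) N _ _ (root r) with ↦d-app-inv r
... | L' , _ , e , _ with plugT-injective (mapᵛ L) L' tt tt e
...   | refl , ()
simulationᵛ-app-value L (vlam B) N _ _ (root r) with ↦d-app-inv r
... | L' , _ , e , refl with plugT-injective (mapᵛ L) L' tt tt e
...   | refl , refl = _ , root (dB L B N) ◅ ε , ≡⇒⟶d* (sym (ᵛ-dB-reduct L B N))
simulationᵛ-app-value L v N simM _ (appL st) with unbang-step (mapᵛ L) (unbangᵛ v) st
... | L' , Q' , refl , st' with simM (subst (_⟶d plugT L' (bang Q')) (sym (ᵛ-plug-value L v)) st')
...   | P , M↠P , X↠Pᵛ =
  app P N , gmap (λ Z → app Z N) appL M↠P ,
  subst (_⟶d* appᵛ (P ᵛ) (N ᵛ)) (appᵛ-plugT-bang L' Q' (N ᵛ)) (appᵛ-⟶d*ˡ (N ᵛ) X↠Pᵛ)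
simulationᵛ-app-value L {V} v N _ simN (appR st) with simN st
... | P , N↠P , X↠Pᵛ =
  app (plug L V) P , gmap (app (plug L V)) appR N↠P ,
  subst (_ ⟶d*_) (sym (ᵛ-app-value L v P)) (gmap (app _) appR X↠Pᵛ)

simulationᵛ-app-der : ∀ M N → decompBang (M ᵛ) ≡ nothing → Simulationᵛ M → Simulationᵛ N →
  ∀ {X} → app (der (M ᵛ)) (N ᵛ) ⟶d X → ∃ λ P → app M N ⟶v* P × X ⟶d* P ᵛ
simulationᵛ-app-der M N nd _ _ (root r) with ↦d-app-inv r
... | L , _ , e , _ with plugT-injective [] L tt tt e
...   | refl , ()
simulationᵛ-app-der M N nd _ _ (appL (root r)) with ↦d-der-inv r
... | L , Q , e with trans (sym (decompBang-plugT-bang L Q)) (trans (cong decompBang (sym e)) nd)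
...   | ()
simulationᵛ-app-der M N nd simM _ (appL (derC st)) with simM st
... | P , M↠P , X↠Pᵛ =
  app P N , gmap (λ Z → app Z N) appL M↠P , (app-der⟶d*appᵛ _ (N ᵛ) ◅◅ appᵛ-⟶d*ˡ (N ᵛ) X↠Pᵛ)
simulationᵛ-app-der M N nd _ simN (appR st) with simN st
... | P , N↠P , X↠Pᵛ =
  app M P , gmap (app M) appR N↠P ,
  subst (_ ⟶d*_) (sym (appᵛ-der (M ᵛ) (P ᵛ) nd)) (gmap (app _) appR X↠Pᵛ)

simulationᵛ-app : ∀ M N → Simulationᵛ M → Simulationᵛ N → Simulationᵛ (app M N)
simulationᵛ-app M N simM simN st with headView M
... | valueIn L v refl =
  simulationᵛ-app-value L v N simM simN (subst (_⟶d _) (ᵛ-app-value L v N) st)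
... | appIn L X Y e =
  simulationᵛ-app-der M N nd simM simN (subst (_⟶d _) (appᵛ-der (M ᵛ) (N ᵛ) nd) st)
  where
  nd : decompBang (M ᵛ) ≡ nothing
  nd = trans (cong decompBang e) (decompBang-plugT-app L X Y)

simulationᵛ : ∀ M → Simulationᵛ M
simulationᵛ (var _) (root ())
simulationᵛ (var _) (bangC (root ()))
simulationᵛ (lam _) (root ())
simulationᵛ (lam _) (bangC (root ()))
simulationᵛ (lam M) (bangC (lamC st)) with simulationᵛ M st
... | P , M↠P , X↠Pᵛ = lam P , gmap lam lamC M↠P , gmap (bang ∘ lam) (λ st' → bangC (lamC st')) X↠Pᵛ
simulationᵛ (app M N) = simulationᵛ-app M N (simulationᵛ M) (simulationᵛ N)
simulationᵛ (es M N) (root r) with ↦d-es-inv r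
... | L , Q , e , refl with ᵛ-plugT-bang-inv N L Q e
...   | L₀ , V , v , refl , refl , refl = _ , root (sv M L₀ V v) ◅ ε , ≡⇒⟶d* (sym (ᵛ-sv-reduct M L₀ v))
simulationᵛ (es M N) (esL st) with simulationᵛ M st
... | P , M↠P , X↠Pᵛ = es P N , gmap (λ Z → es Z N) esL M↠P , gmap (λ Z → es Z (N ᵛ)) esL X↠Pᵛ
simulationᵛ (es M N) (esR st) with simulationᵛ N st
... | P , N↠P , X↠Pᵛ = es M P , gmap (es M) esR N↠P , gmap (es (M ᵛ)) esR X↠Pᵛ

mainTheorem10 : ((M : Λ) (N : Tm) → (M ⁿ) ⟶d N → ∃ λ P → (M ⟶n* P) × (N ⟶d* (P ⁿ)))
    × ((M : Λ) (N : Tm) → (M ᵛ) ⟶d N → ∃ λ P → (M ⟶v* P) × (N ⟶d* (P ᵛ)))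
mainTheorem10 = (λ M _ → simulationⁿ M) , (λ M _ → simulationᵛ M)
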